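{- Suppose that $|A_1|\ge 4$ and let $E=(A_1-A_1)\setminus\{0\}$. There is a numbering $d_1,d_2,\dots$ of the elements of $A_1$ such that, writing $e_{ij}=d_i-d_j$, one of the following holds: (i) $\nu(e_{21})>\nu(e_{31})$; or (ii) there is $h$ with $\nu(e)=h$ for each $e\in E$, $r(e_{31})=2r(e_{21})$, and either (ii.1) $r(e_{41})=3r(e_{21})$, or (ii.2) $r(e_{41})=4r(e_{21})$.
   Context: For a nonzero integer $x$, $\nu(x)$ is the largest $k$ with $7^k\mid x$, and $r(x)$ is the residue modulo $7$ of $x/7^{\nu(x)}$ (relations between $r$-values are modulo 7). $A$ is a set of five integers, none divisible by $7$, with residues modulo $7$ in $\{1,2,4\}$; $A_1$ is a largest subset of $A$ consisting of elements with the same residue modulo $7$. $A_1-A_1=\{a-b:a,b\in A_1\}$. -}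

module Defs where

open import Data.Nat as ℕ using (ℕ; zero; suc)
open import Data.Integer using (ℤ; +_; 0ℤ; ∣_∣; _/ℕ_; _%ℕ_)
import Data.Integer.Properties as ℤP
open import Data.Bool using (if_then_else_; _∧_; not)
open import Data.Product using (_×_; _,_; proj₁; proj₂)
open import Data.Fin using (Fin)
open import Data.Fin.Subset using (Subset; _∈_)
open import Relation.Nullary using (does)
open import Relation.Binary.PropositionalEquality using (_≡_)

strip : ℕ → ℤ → ℕ × ℤ
strip zero    x = 0 , x
strip (suc f) x =
  if not (does (x ℤP.≟ 0ℤ)) ∧ does ((x %ℕ 7) ℕ.≟ 0)
  then (let p = strip f (x /ℕ 7) in suc (proj₁ p) , proj₂ p)
  else (0 , x)

-- ν x : the largest k with 7^k ∣ x  (for x ≠ 0; fuel ∣ x ∣ suffices)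
ν : ℤ → ℕ
ν x = proj₁ (strip ∣ x ∣ x)

-- r x : residue modulo 7 (in {0,…,6}) of x / 7^(ν x)
r : ℤ → ℕ
r x = proj₂ (strip ∣ x ∣ x) %ℕ 7

SameResidue : (Fin 5 → ℤ) → Subset 5 → Set
SameResidue A S = ∀ i j → i ∈ S → j ∈ S → A i %ℕ 7 ≡ A j %ℕ 7

module Submission where

-- Number A₁ as P 0, …, P (n-1) (n ≥ 4) and look at the offsets
-- x i = P (1+i) - P 0 from the base point P 0.
--  * If two offsets have different valuations, alternative (i) holds.
--  * Otherwise every difference is P a - P b = 7^h (u a - u b), with u i the
--    unit part of x i and u 0 = 0.  Two units congruent modulo 7 give a
--    difference of valuation > h next to one of valuation h: alternative (i).
--    Pairwise incongruent units make every valuation h, with r (P a - P b)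
--    the residue of u a - u b; a finite check shows that any four distinct
--    residues 0, b, c, d modulo 7 can be ordered to satisfy alternative (ii).

module Congruence where
  open import Data.Nat as ℕ using (ℕ; zero; suc; _<_)
  import Data.Nat.Properties as ℕP
  open import Data.Nat.Divisibility as ℕDiv using (>⇒∤)
  open import Data.Integer using (ℤ; +_; 0ℤ; _-_; _+_; _*_; -_; ∣_∣; _%ℕ_; _/ℕ_)
  import Data.Integer.Properties as ℤP
  open import Data.Integer.DivMod using (a≡a%ℕn+[a/ℕn]*n; n%ℕd<d)
  open import Data.Integer.Divisibility.Signed using (divides; ∣m∣n⇒∣m+n; ∣m⇒∣-m; ∣⇒∣ᵤ)
    renaming (_∣_ to _∣ₛ_)
  open import Data.Integer.Tactic.RingSolver using (solve-∀)
  open import Data.Empty using (⊥-elim)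
  open import Relation.Binary.PropositionalEquality

  -- Congruence modulo 7: 7 divides the difference.  (A record, so that
  -- the two sides can be inferred from the type.)
  infix 4 _≡₇_
  record _≡₇_ (x y : ℤ) : Set where
    constructor mod7
    field 7∣difference : + 7 ∣ₛ (x - y)

  ≡₇-refl : ∀ x → x ≡₇ x
  ≡₇-refl x = mod7 (divides 0ℤ (ℤP.+-inverseʳ x))

  ≡₇-sym : ∀ {x y} → x ≡₇ y → y ≡₇ x
  ≡₇-sym {x} {y} (mod7 7∣x-y) = mod7 (subst (+ 7 ∣ₛ_) (negate x y) (∣m⇒∣-m 7∣x-y))
    where
    negate : ∀ x y → - (x - y) ≡ y - x
    negate = solve-∀

  ≡₇-trans : ∀ {x y z} → x ≡₇ y → y ≡₇ z → x ≡₇ z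
  ≡₇-trans {x} {y} {z} (mod7 7∣x-y) (mod7 7∣y-z) =
    mod7 (subst (+ 7 ∣ₛ_) (telescope x y z) (∣m∣n⇒∣m+n 7∣x-y 7∣y-z))
    where
    telescope : ∀ x y z → (x - y) + (y - z) ≡ x - z
    telescope = solve-∀

  ≡₇-sub : ∀ {a b c d} → a ≡₇ b → c ≡₇ d → a - c ≡₇ b - d
  ≡₇-sub {a} {b} {c} {d} (mod7 7∣a-b) (mod7 7∣c-d) =
    mod7 (subst (+ 7 ∣ₛ_) (regroup a b c d) (∣m∣n⇒∣m+n 7∣a-b (∣m⇒∣-m 7∣c-d)))
    where
    regroup : ∀ a b c d → (a - b) + - (c - d) ≡ (a - c) - (b - d)
    regroup = solve-∀

  ≡₇-remainder : ∀ x → x ≡₇ + (x %ℕ 7)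
  ≡₇-remainder x = mod7 (divides (x /ℕ 7) (begin
    x - + (x %ℕ 7)                          ≡⟨ cong (_- + (x %ℕ 7)) (a≡a%ℕn+[a/ℕn]*n x 7) ⟩
    (+ (x %ℕ 7) + x /ℕ 7 * + 7) - + (x %ℕ 7) ≡⟨ cancel (+ (x %ℕ 7)) (x /ℕ 7 * + 7) ⟩
    x /ℕ 7 * + 7                            ∎))
    where
    open ≡-Reasoning
    cancel : ∀ s t → (s + t) - s ≡ t
    cancel = solve-∀

  remainders-≡₇ : ∀ {s t} → s < 7 → t < 7 → + s ≡₇ + t → s ≡ t
  remainders-≡₇ {s} {t} s<7 t<7 (mod7 7∣s-t) with ∣ + s - + t ∣ in eq
  ... | zero  = ℤP.+-injective (ℤP.i-j≡0⇒i≡j (+ s) (+ t) (ℤP.∣i∣≡0⇒i≡0 eq))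
  ... | suc k = ⊥-elim (>⇒∤ small (subst (7 ℕDiv.∣_) eq (∣⇒∣ᵤ 7∣s-t)))
    where
    small : suc k < 7
    small = ℕP.≤-<-trans
      (subst (ℕ._≤ s ℕ.⊔ t) (trans (sym (cong ∣_∣ (ℤP.m-n≡m⊖n s t))) eq) (ℤP.∣m⊝n∣≤m⊔n s t))
      (ℕP.⊔-lub s<7 t<7)

  ≡₇⇒%≡ : ∀ {x y} → x ≡₇ y → x %ℕ 7 ≡ y %ℕ 7
  ≡₇⇒%≡ {x} {y} x≡y = remainders-≡₇ (n%ℕd<d x 7) (n%ℕd<d y 7)
    (≡₇-trans (≡₇-sym (≡₇-remainder x)) (≡₇-trans x≡y (≡₇-remainder y)))

  %≡⇒≡₇ : ∀ {x y} → x %ℕ 7 ≡ y %ℕ 7 → x ≡₇ y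
  %≡⇒≡₇ {x} {y} eq = ≡₇-trans (≡₇-remainder x) (subst (λ s → + s ≡₇ y) (sym eq) (≡₇-sym (≡₇-remainder y)))

  ∣⇒%≡0 : ∀ {x} → + 7 ∣ₛ x → x %ℕ 7 ≡ 0
  ∣⇒%≡0 {x} 7∣x = ≡₇⇒%≡ {x} {0ℤ} (mod7 (subst (+ 7 ∣ₛ_) (sym (ℤP.+-identityʳ x)) 7∣x))

module Valuation where
  open import Defs
  open Congruence
  open import Data.Nat as ℕ using (ℕ; zero; suc; _≤_; _<_; z≤n; s≤s)
  import Data.Nat.Properties as ℕP
  open import Data.Integer using (ℤ; +_; 0ℤ; _-_; _+_; _*_; _^_; ∣_∣; _%ℕ_; _/ℕ_)
  import Data.Integer.Properties as ℤP
  open import Data.Integer.DivMod using (a≡a%ℕn+[a/ℕn]*n)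
  open import Data.Integer.Divisibility.Signed using (divides; ∣m⇒∣m*n; ∣-refl)
    renaming (_∣_ to _∣ₛ_)
  open import Data.Product using (_×_; _,_; proj₁; proj₂)
  open import Data.Sum using (inj₁; inj₂)
  open import Data.Empty using (⊥-elim)
  open import Function using (_∘′_)
  open import Relation.Nullary using (¬_; yes; no)
  open import Relation.Binary.PropositionalEquality

  infix 8 7^_
  7^_ : ℕ → ℤ
  7^ k = (+ 7) ^ k

  unit : ℤ → ℤ
  unit x = proj₂ (strip ∣ x ∣ x)

  %≡0⇒≡7* : ∀ {x} → x %ℕ 7 ≡ 0 → x ≡ + 7 * (x /ℕ 7)
  %≡0⇒≡7* {x} eq = begin
    x                          ≡⟨ a≡a%ℕn+[a/ℕn]*n x 7 ⟩
    + (x %ℕ 7) + x /ℕ 7 * + 7  ≡⟨ cong (λ s → + s + x /ℕ 7 * + 7) eq ⟩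
    0ℤ + x /ℕ 7 * + 7          ≡⟨ ℤP.+-identityˡ _ ⟩
    x /ℕ 7 * + 7               ≡⟨ ℤP.*-comm (x /ℕ 7) (+ 7) ⟩
    + 7 * (x /ℕ 7)             ∎
    where open ≡-Reasoning

  strip-factorises : ∀ f x → x ≡ 7^ proj₁ (strip f x) * proj₂ (strip f x)
  strip-factorises zero x = sym (ℤP.*-identityˡ x)
  strip-factorises (suc f) x with x ℤP.≟ 0ℤ | x %ℕ 7 in x%7
  ... | yes _ | _     = sym (ℤP.*-identityˡ x)
  ... | no _  | suc _ = sym (ℤP.*-identityˡ x)
  ... | no _  | zero  = begin
    x                                       ≡⟨ %≡0⇒≡7* x%7 ⟩
    + 7 * (x /ℕ 7)                          ≡⟨ cong (+ 7 *_) (strip-factorises f (x /ℕ 7)) ⟩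
    + 7 * (7^ proj₁ s * proj₂ s)          ≡⟨ ℤP.*-assoc (+ 7) (7^ proj₁ s) (proj₂ s) ⟨
    + 7 * 7^ proj₁ s * proj₂ s            ∎
    where
    open ≡-Reasoning
    s : ℕ × ℤ
    s = strip f (x /ℕ 7)

  strip-exhausts : ∀ f x → x ≢ 0ℤ → ∣ x ∣ ≤ f → ¬ (+ 7 ∣ₛ proj₂ (strip f x))
  strip-exhausts zero x x≢0 ∣x∣≤0 _ = x≢0 (ℤP.∣i∣≡0⇒i≡0 (ℕP.n≤0⇒n≡0 ∣x∣≤0))
  strip-exhausts (suc f) x x≢0 ∣x∣≤f with x ℤP.≟ 0ℤ | x %ℕ 7 in x%7
  ... | yes x≡0 | _     = ⊥-elim (x≢0 x≡0)
  ... | no _    | suc _ = λ 7∣x → ℕP.1+n≢0 (trans (sym x%7) (∣⇒%≡0 7∣x))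
  ... | no _    | zero  = strip-exhausts f (x /ℕ 7) y≢0 (ℕP.≤-pred ∣y∣<∣x∣)
    where
    y : ℤ
    y = x /ℕ 7
    x≡7y : x ≡ + 7 * y
    x≡7y = %≡0⇒≡7* x%7
    y≢0 : y ≢ 0ℤ
    y≢0 y≡0 = x≢0 (trans x≡7y (trans (cong (+ 7 *_) y≡0) (ℤP.*-zeroʳ (+ 7))))
    n<7n : ∀ {n} → n ≢ 0 → n < 7 ℕ.* n
    n<7n {zero}  n≢0 = ⊥-elim (n≢0 refl)
    n<7n {suc n} _   = ℕP.m<m+n (suc n) (s≤s z≤n)
    ∣y∣<∣x∣ : ∣ y ∣ < suc f
    ∣y∣<∣x∣ = ℕP.<-≤-trans (subst (∣ y ∣ <_) (sym (trans (cong ∣_∣ x≡7y) (ℤP.abs-* (+ 7) y)))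
                (n<7n (y≢0 ∘′ ℤP.∣i∣≡0⇒i≡0))) ∣x∣≤f

  factorisation : ∀ x → x ≡ 7^ ν x * unit x
  factorisation x = strip-factorises ∣ x ∣ x

  unit-coprime : ∀ {x} → x ≢ 0ℤ → ¬ (+ 7 ∣ₛ unit x)
  unit-coprime {x} x≢0 = strip-exhausts ∣ x ∣ x x≢0 ℕP.≤-refl

  7∣7* : ∀ y → + 7 ∣ₛ + 7 * y
  7∣7* y = ∣m⇒∣m*n y ∣-refl

  coprime⇒≢0 : ∀ {w} → ¬ (+ 7 ∣ₛ w) → w ≢ 0ℤ
  coprime⇒≢0 7∤w refl = 7∤w (divides 0ℤ refl)

  7^*≢0 : ∀ k {w} → w ≢ 0ℤ → 7^ k * w ≢ 0ℤ
  7^*≢0 k {w} w≢0 eq with ℤP.i*j≡0⇒i≡0∨j≡0 (7^ k) eq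
  ... | inj₁ 7^k≡0 with () ← ℤP.i^n≡0⇒i≡0 (+ 7) k 7^k≡0
  ... | inj₂ w≡0 = w≢0 w≡0

  factorisation-unique : ∀ {a b q w} → ¬ (+ 7 ∣ₛ q) → ¬ (+ 7 ∣ₛ w) → 7^ a * q ≡ 7^ b * w → a ≡ b × q ≡ w
  factorisation-unique {zero} {zero} {q} {w} _ _ eq =
    refl , trans (sym (ℤP.*-identityˡ q)) (trans eq (ℤP.*-identityˡ w))
  factorisation-unique {zero} {suc b} {q} {w} 7∤q _ eq =
    ⊥-elim (7∤q (subst (+ 7 ∣ₛ_) q≡7y (7∣7* (7^ b * w))))
    where
    q≡7y : + 7 * (7^ b * w) ≡ q
    q≡7y = trans (sym (ℤP.*-assoc (+ 7) (7^ b) w)) (trans (sym eq) (ℤP.*-identityˡ q))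
  factorisation-unique {suc a} {zero} 7∤q 7∤w eq with factorisation-unique 7∤w 7∤q (sym eq)
  ... | b≡a , w≡q = sym b≡a , sym w≡q
  factorisation-unique {suc a} {suc b} {q} {w} 7∤q 7∤w eq
    with factorisation-unique {a} {b} 7∤q 7∤w (ℤP.*-cancelˡ-≡ (+ 7) _ _ divide-by-7)
    where
    divide-by-7 : + 7 * (7^ a * q) ≡ + 7 * (7^ b * w)
    divide-by-7 = trans (sym (ℤP.*-assoc (+ 7) (7^ a) q)) (trans eq (ℤP.*-assoc (+ 7) (7^ b) w))
  ... | a≡b , q≡w = cong suc a≡b , q≡w

  valuation-unit : ∀ h {w} → ¬ (+ 7 ∣ₛ w) → ν (7^ h * w) ≡ h × unit (7^ h * w) ≡ w
  valuation-unit h {w} 7∤w =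
    factorisation-unique (unit-coprime x≢0) 7∤w (sym (factorisation (7^ h * w)))
    where
    x≢0 : 7^ h * w ≢ 0ℤ
    x≢0 = 7^*≢0 h (coprime⇒≢0 7∤w)

  valuation-≥ : ∀ k {w} → w ≢ 0ℤ → k ≤ ν (7^ k * w)
  valuation-≥ k {w} w≢0 = subst (k ≤_) (sym ν≡) (ℕP.m≤m+n k (ν w))
    where
    regroup : 7^ k * w ≡ 7^ (k ℕ.+ ν w) * unit w
    regroup = begin
      7^ k * w                 ≡⟨ cong (7^ k *_) (factorisation w) ⟩
      7^ k * (7^ ν w * unit w)  ≡⟨ ℤP.*-assoc (7^ k) (7^ ν w) (unit w) ⟨
      7^ k * 7^ ν w * unit w    ≡⟨ cong (_* unit w) (ℤP.^-distribˡ-+-* (+ 7) k (ν w)) ⟨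
      7^ (k ℕ.+ ν w) * unit w   ∎
      where open ≡-Reasoning
    ν≡ : ν (7^ k * w) ≡ k ℕ.+ ν w
    ν≡ = trans (cong ν regroup) (proj₁ (valuation-unit (k ℕ.+ ν w) (unit-coprime w≢0)))

module ResiduePatterns where
  open import Data.Nat as ℕ using (ℕ; _%_)
  open import Data.Integer using (ℤ; +_; _-_; _%ℕ_)
  open import Data.Fin using (Fin; toℕ; _≟_)
  open import Data.Fin.Patterns using (0F; 1F; 2F; 3F)
  open import Data.Fin.Properties using (all?; any?)
  open import Data.Vec using (_∷_; []; lookup)
  open import Data.Product using (Σ; ∃; _×_; _,_)
  open import Data.Sum using (_⊎_)
  open import Function.Definitions using (Injective)
  open import Relation.Nullary using (Dec)
  open import Relation.Nullary.Decidable using (_×-dec_; _⊎-dec_; _→-dec_; toWitness)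
  open import Relation.Binary.PropositionalEquality using (_≡_)

  ResiduePattern : ℕ → ℕ → ℕ → Set
  ResiduePattern r₂ r₃ r₄ = r₃ ≡ (2 ℕ.* r₂) % 7 × (r₄ ≡ (3 ℕ.* r₂) % 7 ⊎ r₄ ≡ (4 ℕ.* r₂) % 7)

  δ : (Fin 4 → ℤ) → Fin 4 → ℕ
  δ v k = (v k - v 0F) %ℕ 7

  DifferencePattern : (Fin 4 → ℤ) → Set
  DifferencePattern v = ResiduePattern (δ v 1F) (δ v 2F) (δ v 3F)

  differencePattern? : ∀ v → Dec (DifferencePattern v)
  differencePattern? v = (δ v 2F ℕ.≟ _) ×-dec ((δ v 3F ℕ.≟ _) ⊎-dec (δ v 3F ℕ.≟ _))

  -- Injectivity, with explicit arguments so that it can be decided.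
  Distinct : ∀ {m n} → (Fin m → Fin n) → Set
  Distinct f = ∀ i j → f i ≡ f j → i ≡ j

  distinct? : ∀ {m n} (f : Fin m → Fin n) → Dec (Distinct f)
  distinct? f = all? λ i → all? λ j → (f i ≟ f j) →-dec (i ≟ j)

  quad : ∀ {n} → Fin n → Fin n → Fin n → Fin n → Fin 4 → Fin n
  quad a b c d = lookup (a ∷ b ∷ c ∷ d ∷ [])

  GoodOrdering : (Fin 4 → Fin 7) → (Fin 4 → Fin 4) → Set
  GoodOrdering w t = Distinct t × DifferencePattern (λ k → + toℕ (w (t k)))

  goodOrdering? : ∀ w t → Dec (GoodOrdering w t)
  goodOrdering? w t = distinct? t ×-dec differencePattern? (λ k → + toℕ (w (t k)))

  -- The finite check behind residues-orderable, by evaluation over the 120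
  -- choices of b, c, d and the orderings (opaque, so that the evaluation is
  -- not repeated where the result is used).
  opaque
    all-orderable : ∀ b c d → Distinct (quad 0F b c d)
      → ∃ λ e → ∃ λ f → ∃ λ g → ∃ λ h → GoodOrdering (quad 0F b c d) (quad e f g h)
    all-orderable = toWitness {a? = all? λ b → all? λ c → all? λ d → distinct? (quad 0F b c d) →-dec
      any? λ e → any? λ f → any? λ g → any? λ h → goodOrdering? (quad 0F b c d) (quad e f g h)} _

  residues-orderable : ∀ b c d → Injective _≡_ _≡_ (quad 0F b c d)
    → Σ (Fin 4 → Fin 4) (GoodOrdering (quad 0F b c d))
  residues-orderable b c d distinct with all-orderable b c d (λ i j → distinct {i} {j})
  ... | e , f , g , h , good = quad e f g h , good

module Numberings where
  open import Data.Nat as ℕ using (ℕ; zero; suc; _≤_)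
  import Data.Nat.Properties as ℕP
  open import Data.Fin using (Fin; zero; suc; toℕ; fromℕ; fromℕ<; inject₁; inject≤; lower₁; _≟_)
  open import Data.Fin.Properties
    using (toℕ-injective; toℕ-fromℕ; toℕ-fromℕ<; toℕ-inject≤; toℕ-lower₁; inject₁-lower₁; inject₁-injective; suc-injective)
  open import Data.Fin.Subset using (Subset; _∈_; ∣_∣; inside; outside)
  open import Data.Fin.Permutation using (Permutation′; _⟨$⟩ʳ_; _⟨$⟩ˡ_; inverseʳ; transpose; id; _∘ₚ_)
  import Data.Fin.Permutation.Components as Components
  open import Data.Vec using ([]; _∷_; here; there)
  open import Data.Product using (Σ; Σ-syntax; ∃; _×_; _,_; proj₁; proj₂)
  open import Data.Empty using (⊥-elim)
  open import Function using (_∘_)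
  open import Function.Definitions using (Injective)
  open import Relation.Nullary using (yes; no)
  open import Relation.Binary.PropositionalEquality

  IsNumbering : ∀ {m n} → Subset m → (Fin n → Fin m) → Set
  IsNumbering p σ = Injective _≡_ _≡_ σ × (∀ i → σ i ∈ p) × (∀ j → j ∈ p → ∃ λ i → σ i ≡ j)

  numbering : ∀ {m} (p : Subset m) → Σ (Fin ∣ p ∣ → Fin m) (IsNumbering p)
  numbering [] = (λ ()) , (λ { {()} }) , (λ ()) , λ ()
  numbering (outside ∷ p) with numbering p
  ... | σ , σ-inj , σ∈p , σ-onto = (λ i → suc (σ i)) , σ-inj ∘ suc-injective , (λ i → there (σ∈p i)) , onto
    where
    onto : ∀ j → j ∈ outside ∷ p → ∃ λ i → suc (σ i) ≡ j
    onto (suc j) (there j∈p) with σ-onto j j∈p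
    ... | i , σi≡j = i , cong suc σi≡j
  numbering (inside ∷ p) with numbering p
  ... | σ , σ-inj , σ∈p , σ-onto = σ′ , σ′-inj , σ′∈ , onto
    where
    σ′ : Fin (suc ∣ p ∣) → Fin (suc _)
    σ′ zero    = zero
    σ′ (suc i) = suc (σ i)
    σ′-inj : Injective _≡_ _≡_ σ′
    σ′-inj {zero}  {zero}  _  = refl
    σ′-inj {suc i} {suc j} eq = cong suc (σ-inj (suc-injective eq))
    σ′∈ : ∀ i → σ′ i ∈ inside ∷ p
    σ′∈ zero    = here
    σ′∈ (suc i) = there (σ∈p i)
    onto : ∀ j → j ∈ inside ∷ p → ∃ λ i → σ′ i ≡ j
    onto zero    _           = zero , refl
    onto (suc j) (there j∈p) with σ-onto j j∈p
    ... | i , σi≡j = suc i , cong suc σi≡j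

  transpose-sends : ∀ {n} (i j : Fin n) → Components.transpose i j i ≡ j
  transpose-sends i j with i ≟ i
  ... | yes _   = refl
  ... | no i≢i = ⊥-elim (i≢i refl)

  transpose-fixes : ∀ {n} {i j k : Fin n} → k ≢ i → k ≢ j → Components.transpose i j k ≡ k
  transpose-fixes {i = i} {j} {k} k≢i k≢j with k ≟ i
  ... | yes k≡i = ⊥-elim (k≢i k≡i)
  ... | no _ with k ≟ j
  ...   | yes k≡j = ⊥-elim (k≢j k≡j)
  ...   | no _    = refl

  -- Induction on k: extend the permutation
  -- for c's first k-1 values by swapping place k-1 with the preimage of
  -- c's last value, which lies outside the first k-1 places.
  extend-to-permutation : ∀ {k n} (k≤n : k ≤ n) (c : Fin k → Fin n) → Injective _≡_ _≡_ c
    → Σ[ ρ ∈ Permutation′ n ] (∀ i → ρ ⟨$⟩ʳ inject≤ i k≤n ≡ c i)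
  extend-to-permutation {zero}  _   _ _     = id , λ ()
  extend-to-permutation {suc k} {n} k<n c c-inj = transpose last m ∘ₚ ρ , placed
    where
    prefix : Σ[ ρ ∈ Permutation′ n ] (∀ i → ρ ⟨$⟩ʳ inject≤ i (ℕP.<⇒≤ k<n) ≡ c (inject₁ i))
    prefix = extend-to-permutation (ℕP.<⇒≤ k<n) (c ∘ inject₁) (inject₁-injective ∘ c-inj)
    ρ : Permutation′ n
    ρ = proj₁ prefix
    last : Fin n
    last = fromℕ< k<n
    m : Fin n
    m = ρ ⟨$⟩ˡ c (fromℕ k)

    placed : ∀ i → ρ ⟨$⟩ʳ Components.transpose last m (inject≤ i k<n) ≡ c i
    placed i with k ℕ.≟ toℕ i
    ... | yes k≡i = begin
      ρ ⟨$⟩ʳ Components.transpose last m (inject≤ i k<n)  ≡⟨ cong (λ x → ρ ⟨$⟩ʳ Components.transpose last m x) i-is-last ⟩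
      ρ ⟨$⟩ʳ Components.transpose last m last             ≡⟨ cong (ρ ⟨$⟩ʳ_) (transpose-sends last m) ⟩
      ρ ⟨$⟩ʳ m                                            ≡⟨ inverseʳ ρ ⟩
      c (fromℕ k)                                         ≡⟨ cong c (toℕ-injective (trans (toℕ-fromℕ k) k≡i)) ⟩
      c i                                                 ∎
      where
      open ≡-Reasoning
      i-is-last : inject≤ i k<n ≡ last
      i-is-last = toℕ-injective (trans (toℕ-inject≤ i k<n) (trans (sym k≡i) (sym (toℕ-fromℕ< k<n))))
    ... | no k≢i = trans (cong (ρ ⟨$⟩ʳ_) (transpose-fixes x≢last x≢m)) ρx≡ci
      where
      j : Fin k
      j = lower₁ i k≢i
      x : Fin n
      x = inject≤ i k<n
      ρx≡ci : ρ ⟨$⟩ʳ x ≡ c i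
      ρx≡ci = trans (cong (ρ ⟨$⟩ʳ_) (toℕ-injective (trans (toℕ-inject≤ i k<n)
                       (sym (trans (toℕ-inject≤ j _) (toℕ-lower₁ i k≢i))))))
                (trans (proj₂ prefix j) (cong c (inject₁-lower₁ i k≢i)))
      x≢last : x ≢ last
      x≢last x≡last = k≢i (sym (trans (sym (toℕ-inject≤ i k<n)) (trans (cong toℕ x≡last) (toℕ-fromℕ< k<n))))
      x≢m : x ≢ m
      x≢m x≡m = k≢i (trans (sym (toℕ-fromℕ k)) (cong toℕ (c-inj last-value≡ci)))
        where
        last-value≡ci : c (fromℕ k) ≡ c i
        last-value≡ci = trans (sym (inverseʳ ρ)) (trans (cong (ρ ⟨$⟩ʳ_) (sym x≡m)) ρx≡ci)

module Dichotomy where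
  open import Defs
  open Congruence
  open Valuation
  open ResiduePatterns
  open import Data.Nat as ℕ using (ℕ; suc; _>_; _<_)
  import Data.Nat.Properties as ℕP
  open import Data.Integer using (ℤ; +_; 0ℤ; _-_; _*_; _%ℕ_)
  import Data.Integer.Properties as ℤP
  open import Data.Integer.DivMod using (n%ℕd<d)
  open import Data.Integer.Divisibility.Signed using (divides) renaming (_∣_ to _∣ₛ_)
  open import Data.Integer.Tactic.RingSolver using (solve-∀)
  open import Data.Fin using (Fin; suc; toℕ; fromℕ<; _↑ˡ_; _≟_)
  open import Data.Fin.Patterns using (0F; 1F; 2F; 3F)
  open import Data.Fin.Properties using (any?; toℕ-fromℕ<; suc-injective; ↑ˡ-injective)
  open import Data.Product using (Σ; Σ-syntax; ∃; _×_; _,_; proj₁; proj₂)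
  open import Data.Sum using (_⊎_; inj₁; inj₂)
  open import Data.Empty using (⊥-elim)
  open import Function using (_∘_)
  open import Function.Definitions using (Injective)
  open import Relation.Nullary using (¬_; yes; no)
  open import Relation.Nullary.Decidable using (_×-dec_; ¬?)
  open import Relation.Binary.PropositionalEquality

  ValuationDrop : ℤ → ℤ → ℤ → Set
  ValuationDrop d₁ d₂ d₃ = ν (d₂ - d₁) > ν (d₃ - d₁)

  ResidueRelations : ℤ → ℤ → ℤ → ℤ → Set
  ResidueRelations d₁ d₂ d₃ d₄ = ResiduePattern (r (d₂ - d₁)) (r (d₃ - d₁)) (r (d₄ - d₁))

  ResiduePattern-cong : ∀ {r₂ r₃ r₄ s₂ s₃ s₄} → r₂ ≡ s₂ → r₃ ≡ s₃ → r₄ ≡ s₄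
    → ResiduePattern s₂ s₃ s₄ → ResiduePattern r₂ r₃ r₄
  ResiduePattern-cong refl refl refl holds = holds

  UniformValuation : ∀ {n} → (Fin n → ℤ) → ℕ → Set
  UniformValuation P h = ∀ a b → P a - P b ≢ 0ℤ → ν (P a - P b) ≡ h

  Outcome : ∀ {n} → (Fin n → ℤ) → Set
  Outcome {n} P =
    (Σ[ c ∈ (Fin 3 → Fin n) ] Injective _≡_ _≡_ c × ValuationDrop (P (c 0F)) (P (c 1F)) (P (c 2F)))
    ⊎ (Σ[ c ∈ (Fin 4 → Fin n) ] Injective _≡_ _≡_ c × ∃ (UniformValuation P)
         × ResidueRelations (P (c 0F)) (P (c 1F)) (P (c 2F)) (P (c 3F)))

  triple : ∀ {n} → Fin n → Fin n → Fin n → Fin 3 → Fin n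
  triple a b c 0F = a
  triple a b c 1F = b
  triple a b c 2F = c

  triple-injective : ∀ {n} {a b c : Fin n} → a ≢ b → a ≢ c → b ≢ c → Injective _≡_ _≡_ (triple a b c)
  triple-injective a≢b a≢c b≢c {0F} {0F} _ = refl
  triple-injective a≢b a≢c b≢c {0F} {1F} eq = ⊥-elim (a≢b eq)
  triple-injective a≢b a≢c b≢c {0F} {2F} eq = ⊥-elim (a≢c eq)
  triple-injective a≢b a≢c b≢c {1F} {0F} eq = ⊥-elim (a≢b (sym eq))
  triple-injective a≢b a≢c b≢c {1F} {1F} _ = refl
  triple-injective a≢b a≢c b≢c {1F} {2F} eq = ⊥-elim (b≢c eq)
  triple-injective a≢b a≢c b≢c {2F} {0F} eq = ⊥-elim (a≢c (sym eq))
  triple-injective a≢b a≢c b≢c {2F} {1F} eq = ⊥-elim (b≢c (sym eq))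
  triple-injective a≢b a≢c b≢c {2F} {2F} _ = refl

  differencePattern-mod7 : ∀ {v w : Fin 4 → ℤ} → (∀ k → v k ≡₇ w k) → DifferencePattern w → DifferencePattern v
  differencePattern-mod7 {v} {w} v≡w = ResiduePattern-cong (same 1F) (same 2F) (same 3F)
    where
    same : ∀ k → (v k - v 0F) %ℕ 7 ≡ (w k - w 0F) %ℕ 7
    same k = ≡₇⇒%≡ (≡₇-sub (v≡w k) (v≡w 0F))

  module Scaled {n} (P : Fin n → ℤ) (h : ℕ) (u : Fin n → ℤ)
                    (scaled : ∀ a b → P a - P b ≡ 7^ h * (u a - u b)) where

    incongruent-difference : ∀ {a b} → ¬ (u a ≡₇ u b) → ν (P a - P b) ≡ h × r (P a - P b) ≡ (u a - u b) %ℕ 7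
    incongruent-difference {a} {b} u-incongruent =
      trans (cong ν (scaled a b)) (proj₁ unit-part) , trans (cong r (scaled a b)) (cong (_%ℕ 7) (proj₂ unit-part))
      where
      unit-part : ν (7^ h * (u a - u b)) ≡ h × unit (7^ h * (u a - u b)) ≡ u a - u b
      unit-part = valuation-unit h (u-incongruent ∘ mod7)

    collision-drop : ∀ {a b c} → P a ≢ P b → u a ≡₇ u b → ¬ (u c ≡₇ u b) → ValuationDrop (P b) (P a) (P c)
    collision-drop {a} {b} {c} Pa≢Pb (mod7 (divides q u-diff)) u-incongruent =
      subst (_< ν (P a - P b)) (sym (proj₁ (incongruent-difference u-incongruent)))
        (subst (λ x → suc h ℕ.≤ ν x) (sym P-diff) (valuation-≥ (suc h) q≢0))
      where
      regroup : ∀ p q s → p * (q * s) ≡ s * p * q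
      regroup = solve-∀
      P-diff : P a - P b ≡ 7^ suc h * q
      P-diff = trans (scaled a b) (trans (cong (7^ h *_) u-diff) (regroup (7^ h) q (+ 7)))
      q≢0 : q ≢ 0ℤ
      q≢0 q≡0 = Pa≢Pb (ℤP.i-j≡0⇒i≡j _ _ (trans P-diff (trans (cong (7^ suc h *_) q≡0) (ℤP.*-zeroʳ (7^ suc h)))))


  residue : ℤ → Fin 7
  residue x = fromℕ< (n%ℕd<d x 7)

  ≡₇-residue : ∀ x → x ≡₇ + toℕ (residue x)
  ≡₇-residue x = subst (λ s → x ≡₇ + s) (sym (toℕ-fromℕ< (n%ℕd<d x 7))) (≡₇-remainder x)

  separated-outcome : ∀ {m} (P : Fin (4 ℕ.+ m) → ℤ) (h : ℕ) (u : Fin (4 ℕ.+ m) → ℤ)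
    → (scaled : ∀ a b → P a - P b ≡ 7^ h * (u a - u b)) → u 0F ≡ 0ℤ
    → (∀ a b → a ≢ b → ¬ (u a ≡₇ u b)) → Outcome P
  separated-outcome {m} P h u scaled u0≡0 separated =
    inj₂ (c , c-injective , (h , uniform) ,
          ResiduePattern-cong (r-difference 1F λ ()) (r-difference 2F λ ()) (r-difference 3F λ ()) u-pattern)
    where
    open Scaled P h u scaled
    ι : Fin 4 → Fin (4 ℕ.+ m)
    ι k = k ↑ˡ m

    w : Fin 4 → Fin 7
    w = quad 0F (residue (u 1F)) (residue (u 2F)) (residue (u 3F))
    u≡w : ∀ k → u (ι k) ≡₇ + toℕ (w k)
    u≡w 0F = subst (_≡₇ 0ℤ) (sym u0≡0) (≡₇-refl 0ℤ)
    u≡w 1F = ≡₇-residue (u 1F)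
    u≡w 2F = ≡₇-residue (u 2F)
    u≡w 3F = ≡₇-residue (u 3F)
    w-injective : Injective _≡_ _≡_ w
    w-injective {k} {l} wk≡wl with k ≟ l
    ... | yes k≡l = k≡l
    ... | no k≢l = ⊥-elim (separated (ι k) (ι l) (k≢l ∘ ↑ˡ-injective m k l)
                     (≡₇-trans (u≡w k) (subst (λ x → + toℕ x ≡₇ u (ι l)) (sym wk≡wl) (≡₇-sym (u≡w l)))))

    ordering : Σ (Fin 4 → Fin 4) (GoodOrdering w)
    ordering = residues-orderable _ _ _ w-injective
    t : Fin 4 → Fin 4
    t = proj₁ ordering
    c : Fin 4 → Fin (4 ℕ.+ m)
    c k = ι (t k)
    c-injective : Injective _≡_ _≡_ c
    c-injective {k} {l} eq = proj₁ (proj₂ ordering) k l (↑ˡ-injective m (t k) (t l) eq)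
    u-pattern : DifferencePattern (u ∘ c)
    u-pattern = differencePattern-mod7 (λ k → u≡w (t k)) (proj₂ (proj₂ ordering))

    uniform : UniformValuation P h
    uniform a b Pa-Pb≢0 = proj₁ (incongruent-difference (separated a b a≢b))
      where
      a≢b : a ≢ b
      a≢b refl = Pa-Pb≢0 (ℤP.+-inverseʳ (P a))
    r-difference : ∀ k → k ≢ 0F → r (P (c k) - P (c 0F)) ≡ (u (c k) - u (c 0F)) %ℕ 7
    r-difference k k≢0 = proj₂ (incongruent-difference (separated (c k) (c 0F) (k≢0 ∘ c-injective)))

  module Classification {m} (P : Fin (4 ℕ.+ m) → ℤ) (P-inj : Injective _≡_ _≡_ P) where

    x : Fin (3 ℕ.+ m) → ℤ
    x i = P (suc i) - P 0F

    x≢0 : ∀ i → x i ≢ 0ℤ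
    x≢0 i xi≡0 with P-inj (ℤP.i-j≡0⇒i≡j _ _ xi≡0)
    ... | ()

    -- When all offsets have the same valuation h, P is 7^h times the family u
    -- of their unit parts (with u 0 = 0); the outcome depends on whether two
    -- unit parts are congruent modulo 7.
    module CommonValuation (ν-x : ∀ i → ν (x i) ≡ ν (x 0F)) where
      h : ℕ
      h = ν (x 0F)

      u : Fin (4 ℕ.+ m) → ℤ
      u 0F      = 0ℤ
      u (suc i) = unit (x i)

      offset : ∀ a → P a - P 0F ≡ 7^ h * u a
      offset 0F      = trans (ℤP.+-inverseʳ (P 0F)) (sym (ℤP.*-zeroʳ (7^ h)))
      offset (suc i) = trans (factorisation (x i)) (cong (λ k → 7^ k * unit (x i)) (ν-x i))

      scaled : ∀ a b → P a - P b ≡ 7^ h * (u a - u b)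
      scaled a b = begin
        P a - P b                           ≡⟨ rebase (P a) (P b) (P 0F) ⟩
        (P a - P 0F) - (P b - P 0F)          ≡⟨ cong₂ _-_ (offset a) (offset b) ⟩
        7^ h * u a - 7^ h * u b              ≡⟨ factor (7^ h) (u a) (u b) ⟩
        7^ h * (u a - u b)                   ∎
        where
        open ≡-Reasoning
        rebase : ∀ p q o → p - q ≡ (p - o) - (q - o)
        rebase = solve-∀
        factor : ∀ k a b → k * a - k * b ≡ k * (a - b)
        factor = solve-∀

      u-unit : ∀ i → ¬ (u (suc i) ≡₇ u 0F)
      u-unit i (mod7 7∣ui) = unit-coprime (x≢0 i) (subst (+ 7 ∣ₛ_) (ℤP.+-identityʳ (unit (x i))) 7∣ui)

      outcome : Outcome P
      outcome with any? (λ i → any? (λ j → ¬? (i ≟ j) ×-dec (u (suc i) %ℕ 7 ℕ.≟ u (suc j) %ℕ 7)))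
      ... | yes (i , j , i≢j , same) =
        inj₁ (triple (suc j) (suc i) 0F , triple-injective (i≢j ∘ sym ∘ suc-injective) (λ ()) (λ ()) ,
              collision-drop (i≢j ∘ suc-injective ∘ P-inj) (%≡⇒≡₇ same) (u-unit j ∘ ≡₇-sym))
        where open Scaled P h u scaled
      ... | no no-collision = separated-outcome P h u scaled refl separated
        where
        separated : ∀ a b → a ≢ b → ¬ (u a ≡₇ u b)
        separated 0F      0F      0≢0 _       = 0≢0 refl
        separated 0F      (suc j) _   u0≡uj   = u-unit j (≡₇-sym u0≡uj)
        separated (suc i) 0F      _   ui≡u0   = u-unit i ui≡u0
        separated (suc i) (suc j) a≢b ui≡uj = no-collision (i , j , a≢b ∘ cong suc , ≡₇⇒%≡ ui≡uj)

    classify : Outcome P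
    classify with any? (λ i → any? (λ j → ν (x j) ℕ.<? ν (x i)))
    ... | yes (i , j , ν-drop) =
      inj₁ (triple 0F (suc i) (suc j) , triple-injective (λ ()) (λ ()) (i≢j ∘ suc-injective) , ν-drop)
      where
      i≢j : i ≢ j
      i≢j refl = ℕP.<-irrefl refl ν-drop
    ... | no no-drop = CommonValuation.outcome ν-x
      where
      ν-x : ∀ i → ν (x i) ≡ ν (x 0F)
      ν-x i = ℕP.≤-antisym (ℕP.≮⇒≥ λ lt → no-drop (i , 0F , lt)) (ℕP.≮⇒≥ λ lt → no-drop (0F , i , lt))

  open Classification public using (classify)

open import Defs
open import Data.Nat as ℕ using (ℕ; _≤_; _>_; _*_; _%_)
open import Data.Integer using (ℤ; +_; 0ℤ; _-_; _%ℕ_)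
open import Data.Integer.Divisibility using (_∣_)
open import Data.Fin using (Fin; zero; suc; inject≤)
open import Data.Fin.Subset using (Subset; _∈_; ∣_∣)
open import Data.Product using (Σ; ∃; _×_)
open import Data.Sum using (_⊎_)
open import Relation.Nullary using (¬_)
open import Relation.Binary.PropositionalEquality using (_≡_; _≢_)
open import Function.Definitions using (Injective)

open Numberings
open Dichotomy
open import Data.Nat using (s≤s; z≤n)
open import Data.Fin.Patterns using (0F; 1F; 2F; 3F)
open import Data.Fin.Permutation using (Permutation′; _⟨$⟩ʳ_; _⟨$⟩ˡ_; inverseʳ; inverseˡ)
open import Data.Product using (_,_; proj₁; proj₂)
open import Data.Sum using (inj₁; inj₂)
open import Function using (_∘_)
open import Relation.Binary.PropositionalEquality using (refl; sym; trans; cong)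

Alternatives : ∀ {m} → (Fin m → ℤ) → Subset m → (Fin 4 → ℤ) → Set
Alternatives A p d =
  ValuationDrop (d 0F) (d 1F) (d 2F)
  ⊎ (∃ (λ (h : ℕ) → ∀ a b → a ∈ p → b ∈ p → A a - A b ≢ 0ℤ → ν (A a - A b) ≡ h))
    × ResidueRelations (d 0F) (d 1F) (d 2F) (d 3F)

ValuationDrop-cong : ∀ {d₁ d₂ d₃ e₁ e₂ e₃} → d₁ ≡ e₁ → d₂ ≡ e₂ → d₃ ≡ e₃
  → ValuationDrop d₁ d₂ d₃ → ValuationDrop e₁ e₂ e₃
ValuationDrop-cong refl refl refl drop = drop

ResidueRelations-cong : ∀ {d₁ d₂ d₃ d₄ e₁ e₂ e₃ e₄} → d₁ ≡ e₁ → d₂ ≡ e₂ → d₃ ≡ e₃ → d₄ ≡ e₄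
  → ResidueRelations d₁ d₂ d₃ d₄ → ResidueRelations e₁ e₂ e₃ e₄
ResidueRelations-cong refl refl refl refl relations = relations

permute-numbering : ∀ {m n} {p : Subset m} {σ : Fin n → Fin m}
  → IsNumbering p σ → (ρ : Permutation′ n) → IsNumbering p (σ ∘ (ρ ⟨$⟩ʳ_))
permute-numbering {σ = σ} (σ-inj , σ∈p , σ-onto) ρ = ρσ-inj , (λ i → σ∈p (ρ ⟨$⟩ʳ i)) , onto
  where
  ρσ-inj : Injective _≡_ _≡_ (σ ∘ (ρ ⟨$⟩ʳ_))
  ρσ-inj {i} {j} eq = trans (sym (inverseˡ ρ)) (trans (cong (ρ ⟨$⟩ˡ_) (σ-inj eq)) (inverseˡ ρ))
  onto : ∀ j → j ∈ _ → ∃ λ i → σ (ρ ⟨$⟩ʳ i) ≡ j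
  onto j j∈p with σ-onto j j∈p
  ... | i , σi≡j = ρ ⟨$⟩ˡ i , trans (cong σ (inverseʳ ρ)) σi≡j

uniform-on-members : ∀ {m n} {A : Fin m → ℤ} {p : Subset m} {σ : Fin n → Fin m} {h : ℕ}
  → IsNumbering p σ → UniformValuation (A ∘ σ) h
  → ∀ a b → a ∈ p → b ∈ p → A a - A b ≢ 0ℤ → ν (A a - A b) ≡ h
uniform-on-members (_ , _ , σ-onto) uniform a b a∈p b∈p with σ-onto a a∈p | σ-onto b b∈p
... | i , refl | j , refl = uniform i j

-- Given any numbering σ₀ of at least four members of p, permuting it so
-- that the indices produced by the classification come first yields a
-- numbering satisfying one of the alternatives.
renumber : ∀ {m n} (A : Fin m → ℤ) → Injective _≡_ _≡_ A → (p : Subset m)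
  → (σ₀ : Fin n → Fin m) → IsNumbering p σ₀ → (4≤n : 4 ≤ n)
  → Σ (Fin n → Fin m) λ σ → IsNumbering p σ × Alternatives A p (λ k → A (σ (inject≤ k 4≤n)))
renumber A A-inj p σ₀ σ₀-numbering 4≤n@(s≤s (s≤s (s≤s (s≤s _))))
  with classify (A ∘ σ₀) (proj₁ σ₀-numbering ∘ A-inj)
... | inj₁ (c , c-inj , drop) with extend-to-permutation (s≤s (s≤s (s≤s z≤n))) c c-inj
...   | ρ , placed = σ₀ ∘ (ρ ⟨$⟩ʳ_) , permute-numbering σ₀-numbering ρ ,
                     inj₁ (ValuationDrop-cong (at 0F) (at 1F) (at 2F) drop)
  where
  at : ∀ k → A (σ₀ (c k)) ≡ A (σ₀ (ρ ⟨$⟩ʳ inject≤ k _))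
  at k = cong (A ∘ σ₀) (sym (placed k))
renumber A A-inj p σ₀ σ₀-numbering 4≤n@(s≤s (s≤s (s≤s (s≤s _))))
    | inj₂ (c , c-inj , (h , uniform) , relations) with extend-to-permutation 4≤n c c-inj
...   | ρ , placed = σ₀ ∘ (ρ ⟨$⟩ʳ_) , permute-numbering σ₀-numbering ρ ,
                     inj₂ ((h , uniform-on-members {A = A} σ₀-numbering uniform) ,
                           ResidueRelations-cong (at 0F) (at 1F) (at 2F) (at 3F) relations)
  where
  at : ∀ k → A (σ₀ (c k)) ≡ A (σ₀ (ρ ⟨$⟩ʳ inject≤ k 4≤n))
  at k = cong (A ∘ σ₀) (sym (placed k))

lemma7 : (A : Fin 5 → ℤ) → Injective _≡_ _≡_ A
       → (∀ i → ¬ (+ 7 ∣ A i))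
       → (∀ i → (A i %ℕ 7 ≡ 1) ⊎ (A i %ℕ 7 ≡ 2) ⊎ (A i %ℕ 7 ≡ 4))
       → (A₁ : Subset 5) → SameResidue A A₁
       → (∀ (S : Subset 5) → SameResidue A S → ∣ S ∣ ≤ ∣ A₁ ∣)
       → (h4 : 4 ≤ ∣ A₁ ∣)
       → Σ (Fin ∣ A₁ ∣ → Fin 5) (λ σ →
           Injective _≡_ _≡_ σ
           × (∀ i → σ i ∈ A₁)
           × (∀ j → j ∈ A₁ → ∃ (λ i → σ i ≡ j))
           × (let d : Fin 4 → ℤ
                  d k = A (σ (inject≤ k h4))
                  e : Fin 4 → Fin 4 → ℤ
                  e i j = d i - d j
                  d₁ = zero
                  d₂ = suc zero
                  d₃ = suc (suc zero)
                  d₄ = suc (suc (suc zero))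
              in (ν (e d₂ d₁) > ν (e d₃ d₁))
                 ⊎ (∃ (λ (h : ℕ) → ∀ a b → a ∈ A₁ → b ∈ A₁ → A a - A b ≢ 0ℤ → ν (A a - A b) ≡ h)
                    × (r (e d₃ d₁) ≡ (2 * r (e d₂ d₁)) % 7)
                    × ((r (e d₄ d₁) ≡ (3 * r (e d₂ d₁)) % 7)
                       ⊎ (r (e d₄ d₁) ≡ (4 * r (e d₂ d₁)) % 7)))))
lemma7 A A-inj _ _ A₁ _ _ h4 with renumber A A-inj A₁ (proj₁ (numbering A₁)) (proj₂ (numbering A₁)) h4
... | σ , (σ-inj , σ∈A₁ , σ-onto) , alternatives = σ , σ-inj , σ∈A₁ , σ-onto , alternatives
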